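{- Let $c,h\in\omega^\omega$ with $c>h$ and $h(i)\ge1$ for all but finitely many $i$, and let $g\in\omega^\omega$ go to infinity. If $p\in\mathbb{Q}_{c,h}$, then there is a condition $q\le p$ in $\mathbb{Q}^*_{c,h}$ such that $|\mathrm{poss}(q,<s_n(q))|<g(s_n(q))$ for all $n<\omega$.
   Context: Natural numbers are identified with $\{0,\dots,n-1\}$. The poset $\mathbb{Q}_{c,h}$: for non-empty $M\subseteq[c(n)]^{\le h(n)}$ let $\|M\|_{c,h,n}:=\max\{k\mid\forall Y\in[c(n)]^{\le k}\ \exists X\in M: Y\subseteq X\}$. Conditions are sequences $p=\langle p(n)\mid n<\omega\rangle$ with each $p(n)$ a non-empty subset of $[c(n)]^{\le h(n)}$ and $\limsup_n\|p(n)\|_{c,h,n}=\infty$; $q\le p$ iff $q(n)\subseteq p(n)$ for all $n$. $\mathrm{split}(p):=\{k\mid|p(k)|>1\}$, $s_n(p)$ its $n$-th element in increasing order. $\mathbb{Q}^*_{c,h}$ is the set of $p\in\mathbb{Q}_{c,h}$ with $\|p(s_n(p))\|_{c,h,s_n(p)}\ge n+1$ for all $n$. $\mathrm{poss}(p,\le k):=\{\langle\{z(\ell)\}\mid\ell\le k\rangle\mid\forall\ell\le k: z(\ell)\in p(\ell)\}$ and $\mathrm{poss}(p,<k):=\mathrm{poss}(p,\le k-1)$ (a one-element set consisting of the empty sequence when $k=0$). -}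

module Defs where

open import Data.Nat using (ℕ; zero; suc; _+_; _*_; _≤_; _<_; _<ᵇ_)
open import Data.Bool using (Bool; true; false; if_then_else_)
open import Data.Unit using (⊤; tt)
open import Data.Product using (Σ; ∃; _×_; _,_)
open import Data.List using (List; []; _∷_; [_]; _++_; map; filterᵇ; length; concatMap)
open import Data.Vec using (Vec; []; _∷_)
open import Data.Fin.Subset using (Subset; inside; outside; _⊆_; ∣_∣)
open import Relation.Binary.PropositionalEquality using (_≡_)

-- A subset of [c(n)]^{≤h(n)} (or of any finite power set) is represented by
-- its (Boolean) characteristic function on Subset m = subsets of {0,…,m-1}.
SetOfSubsets : ℕ → Set
SetOfSubsets m = Subset m → Bool

allSubsets : (m : ℕ) → List (Subset m)
allSubsets zero    = [ [] ]
allSubsets (suc m) = map (outside ∷_) (allSubsets m) ++ map (inside ∷_) (allSubsets m)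

members : ∀ {m} → SetOfSubsets m → List (Subset m)
members {m} M = filterᵇ M (allSubsets m)

card : ∀ {m} → SetOfSubsets m → ℕ
card M = length (members M)

_∈ˢ_ : ∀ {m} → Subset m → SetOfSubsets m → Set
X ∈ˢ M = M X ≡ true

-- ‖M‖_{c,h,n} ≥ k, i.e. k ≤ max{k' | every Y ∈ [c(n)]^{≤k'} is covered by some X ∈ M}.
-- (The set of such k' is downward closed, so this is exactly "k belongs to it".)
NormAtLeast : ∀ {m} → SetOfSubsets m → ℕ → Set
NormAtLeast {m} M k = (Y : Subset m) → ∣ Y ∣ ≤ k → Σ (Subset m) λ X → X ∈ˢ M × Y ⊆ X

Seqᶜ : (ℕ → ℕ) → Set
Seqᶜ c = (n : ℕ) → SetOfSubsets (c n)

IsCondition : (c h : ℕ → ℕ) → Seqᶜ c → Set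
IsCondition c h p =
  ((n : ℕ) (X : Subset (c n)) → X ∈ˢ p n → ∣ X ∣ ≤ h n)
  × ((n : ℕ) → Σ (Subset (c n)) λ X → X ∈ˢ p n)
  × ((k N : ℕ) → Σ ℕ λ n → N ≤ n × NormAtLeast (p n) k)

_≤ᶜ_ : ∀ {c} → Seqᶜ c → Seqᶜ c → Set
_≤ᶜ_ {c} q p = (n : ℕ) (X : Subset (c n)) → X ∈ˢ q n → X ∈ˢ p n

splitsBelow : ∀ {c} → Seqᶜ c → ℕ → ℕ
splitsBelow p zero    = 0
splitsBelow p (suc j) = splitsBelow p j + (if 1 <ᵇ card (p j) then 1 else 0)

-- k = s_n(p): k ∈ split(p) and exactly n elements of split(p) lie below k
IsSplit : ∀ {c} → Seqᶜ c → ℕ → ℕ → Set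
IsSplit p n k = 1 < card (p k) × splitsBelow p k ≡ n

IsStarCondition : (c h : ℕ → ℕ) → Seqᶜ c → Set
IsStarCondition c h p =
  IsCondition c h p × ((n k : ℕ) → IsSplit p n k → NormAtLeast (p k) (suc n))

-- poss(p,<k): sequences ⟨{z(ℓ)} | ℓ < k⟩ with z(ℓ) ∈ p(ℓ); a sequence is
-- represented by the tuple of the z(ℓ)'s.
PossSeq : (c : ℕ → ℕ) → ℕ → Set
PossSeq c zero    = ⊤
PossSeq c (suc k) = PossSeq c k × Subset (c k)

poss< : ∀ {c} → Seqᶜ c → (k : ℕ) → List (PossSeq c k)
poss< p zero    = [ tt ]
poss< p (suc k) = concatMap (λ s → map (λ z → (s , z)) (members (p k))) (poss< p k)

possCard : ∀ {c} → Seqᶜ c → ℕ → ℕ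
possCard p k = length (poss< p k)

module Submission where

-- Choose levels k₀ < k₁ < … recursively, k_m with ‖p(k_m)‖ ≥ m+1
-- and g(k_m) > B_m, where B_m = Π_{i<m} |p(k_i)| (possible because the
-- norms of p are unbounded and g tends to infinity).  Let q keep p at the
-- chosen levels and shrink p(ℓ) to one fixed element elsewhere.  Then
-- split(q) = {k_m}, since |p(k_m)| ≥ 2 by the norm bound and c > h; hence
-- s_m(q) = k_m, ‖q(s_m(q))‖ ≥ m+1 and |poss(q,<k_m)| ≤ B_m < g(k_m).

open import Defs
open import Data.Nat using (ℕ; zero; suc; _≤_; _<_; _+_; _*_; _⊔_; z≤n; s≤s; _<ᵇ_; _≟_; _≤′_; ≤′-reflexive; ≤′-step)
open import Data.Nat.Properties
open import Data.Product using (Σ; _×_; _,_; proj₁; proj₂)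
open import Data.Bool using (true; false; T; if_then_else_)
import Data.Bool as Bool
open import Data.Bool.Properties using (T-≡)
open import Function.Bundles using (Equivalence)
open import Data.Unit using (tt)
open import Data.List using (List; []; _∷_; map; length; concatMap)
open import Data.List.Properties using (length-++; length-map)
open import Data.List.Membership.Propositional using (_∈_)
open import Data.List.Membership.Propositional.Properties using (∈-map⁺; ∈-map⁻; ∈-++⁺ˡ; ∈-++⁺ʳ; ∈-filter⁺; ∈-filter⁻)
open import Data.List.Relation.Unary.Any using (here; there)
open import Data.List.Relation.Unary.All using ([]; _∷_)
open import Data.List.Relation.Unary.AllPairs using ([]; _∷_)
open import Data.List.Relation.Unary.Unique.Propositional using (Unique)
import Data.List.Relation.Unary.Unique.Propositional.Properties as Unique
open import Data.Vec using ([]; _∷_)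
import Data.Vec as Vec
open import Data.Vec.Properties using (≡-dec)
open import Data.Fin using (Fin; zero; suc)
open import Data.Fin.Subset using (Subset; inside; outside; ∣_∣; ⁅_⁆) renaming (_∈_ to _∈ₛ_)
open import Data.Fin.Subset.Properties using (x∈⁅x⁆; ∣⁅x⁆∣≡1)
open import Relation.Nullary using (¬_; Dec; yes; no; contradiction)
open import Relation.Nullary.Decidable using (isYes; T?; map′; decidable-stable)
open import Relation.Binary.PropositionalEquality using (_≡_; _≢_; refl; sym; trans; cong; cong₂; subst; module ≡-Reasoning)
open import Function using (_∘_)

allSubsets-complete : ∀ m (X : Subset m) → X ∈ allSubsets m
allSubsets-complete zero    []            = here refl
allSubsets-complete (suc m) (outside ∷ X) = ∈-++⁺ˡ (∈-map⁺ (outside ∷_) (allSubsets-complete m X))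
allSubsets-complete (suc m) (inside ∷ X)  =
  ∈-++⁺ʳ (map (outside ∷_) (allSubsets m)) (∈-map⁺ (inside ∷_) (allSubsets-complete m X))

allSubsets-unique : ∀ m → Unique (allSubsets m)
allSubsets-unique zero    = [] ∷ []
allSubsets-unique (suc m) =
  Unique.++⁺ (Unique.map⁺ tail-injective (allSubsets-unique m))
             (Unique.map⁺ tail-injective (allSubsets-unique m)) disjoint
  where
  tail-injective : ∀ {b} {X Y : Subset m} → _≡_ {A = Subset (suc m)} (b ∷ X) (b ∷ Y) → X ≡ Y
  tail-injective refl = refl

  disjoint : ∀ {Z} → ¬ (Z ∈ map (outside ∷_) (allSubsets m) × Z ∈ map (inside ∷_) (allSubsets m))
  disjoint (Z∈out , Z∈in) with ∈-map⁻ (outside ∷_) Z∈out | ∈-map⁻ (inside ∷_) Z∈in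
  ... | _ , _ , refl | _ , _ , ()

∈-members : ∀ {m} (M : SetOfSubsets m) {X} → X ∈ˢ M → X ∈ members M
∈-members {m} M {X} X∈M = ∈-filter⁺ (T? ∘ M) (allSubsets-complete m X) (Equivalence.from T-≡ X∈M)

members-∈ : ∀ {m} (M : SetOfSubsets m) {X} → X ∈ members M → X ∈ˢ M
members-∈ {m} M X∈ = Equivalence.to T-≡ (proj₂ (∈-filter⁻ (T? ∘ M) {xs = allSubsets m} X∈))

members-unique : ∀ {m} (M : SetOfSubsets m) → Unique (members M)
members-unique {m} M = Unique.filter⁺ (T? ∘ M) (allSubsets-unique m)

length≥2 : ∀ {A : Set} {xs : List A} {a b : A} → a ∈ xs → b ∈ xs → a ≢ b → 2 ≤ length xs
length≥2 {xs = _ ∷ _ ∷ _} _          _          _   = s≤s (s≤s z≤n)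
length≥2 {xs = _ ∷ []}    (here refl) (here refl) a≢b = contradiction refl a≢b

length≤1 : ∀ {A : Set} {xs : List A} (X : A) → Unique xs → (∀ {y} → y ∈ xs → y ≡ X) → length xs ≤ 1
length≤1 {xs = []}         _ _                 _      = z≤n
length≤1 {xs = _ ∷ []}     _ _                 _      = s≤s z≤n
length≤1 {xs = _ ∷ _ ∷ _} _ ((x≢y ∷ _) ∷ _) all≡X =
  contradiction (trans (all≡X (here refl)) (sym (all≡X (there (here refl))))) x≢y

card≥2 : ∀ {m} (M : SetOfSubsets m) {X Y} → X ∈ˢ M → Y ∈ˢ M → X ≢ Y → 2 ≤ card M
card≥2 M X∈M Y∈M = length≥2 (∈-members M X∈M) (∈-members M Y∈M)

card≤1 : ∀ {m} (M : SetOfSubsets m) (X : Subset m) → (∀ {Y} → Y ∈ˢ M → Y ≡ X) → card M ≤ 1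
card≤1 M X all≡X = length≤1 X (members-unique M) (all≡X ∘ members-∈ M)

singleton : ∀ {m} → Subset m → SetOfSubsets m
singleton X Y = isYes (≡-dec Bool._≟_ Y X)

∈-singleton : ∀ {m} {X Y : Subset m} → Y ∈ˢ singleton X → Y ≡ X
∈-singleton {X = X} {Y} Y∈ with ≡-dec Bool._≟_ Y X
... | yes Y≡X = Y≡X

singleton-self : ∀ {m} (X : Subset m) → X ∈ˢ singleton X
singleton-self X with ≡-dec Bool._≟_ X X
... | yes _   = refl
... | no X≢X = contradiction refl X≢X

card-singleton : ∀ {m} (X : Subset m) → card (singleton X) ≤ 1
card-singleton X = card≤1 (singleton X) X ∈-singleton

NormAtLeast-mono : ∀ {m} (M : SetOfSubsets m) {a b} → b ≤ a → NormAtLeast M a → NormAtLeast M b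
NormAtLeast-mono M b≤a norm Y ∣Y∣≤b = norm Y (≤-trans ∣Y∣≤b b≤a)

missingIndex : ∀ {m} (X : Subset m) → ∣ X ∣ < m → Σ (Fin m) λ i → ¬ (i ∈ₛ X)
missingIndex (outside ∷ X) _         = zero , λ ()
missingIndex (inside ∷ X) (s≤s ∣X∣<m) with missingIndex X ∣X∣<m
... | i , i∉X = suc i , λ { (Vec.there i∈X) → i∉X i∈X }

-- If all members of M are proper subsets of {0,…,m-1} and M covers every
-- singleton (‖M‖ ≥ 1), then M has two elements: the cover X₀ of {0} misses
-- some i, and the cover of {i} differs from X₀.
norm≥1⇒card≥2 : ∀ {m} (M : SetOfSubsets m) → (∀ X → X ∈ˢ M → ∣ X ∣ < m) → NormAtLeast M 1 → 2 ≤ card M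
norm≥1⇒card≥2 {zero}  M proper norm with norm [] z≤n
... | [] , []∈M , _ = contradiction (proper [] []∈M) n≮0
norm≥1⇒card≥2 {suc m} M proper norm with norm ⁅ zero ⁆ (≤-reflexive (∣⁅x⁆∣≡1 {suc m} zero))
... | X₀ , X₀∈M , _ with missingIndex X₀ (proper X₀ X₀∈M)
... | i , i∉X₀ with norm ⁅ i ⁆ (≤-reflexive (∣⁅x⁆∣≡1 {suc m} i))
... | X₁ , X₁∈M , ⁅i⁆⊆X₁ = card≥2 M X₀∈M X₁∈M (λ X₀≡X₁ → i∉X₀ (subst (i ∈ₛ_) (sym X₀≡X₁) (⁅i⁆⊆X₁ (x∈⁅x⁆ i))))

length-pairs : ∀ {A B : Set} (xs : List A) (L : List B) →
  length (concatMap (λ s → map (λ z → (s , z)) L) xs) ≡ length xs * length L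
length-pairs []       L = refl
length-pairs (x ∷ xs) L = trans (length-++ (map _ L)) (cong₂ _+_ (length-map _ L) (length-pairs xs L))

possCard-suc : ∀ {c} (q : Seqᶜ c) k → possCard q (suc k) ≡ possCard q k * card (q k)
possCard-suc q k = length-pairs (poss< q k) (members (q k))

indicator-split : ∀ n → 1 < n → (if 1 <ᵇ n then 1 else 0) ≡ 1
indicator-split n 1<n with 1 <ᵇ n | <⇒<ᵇ 1<n
... | true | _ = refl

indicator-trivial : ∀ n → n ≤ 1 → (if 1 <ᵇ n then 1 else 0) ≡ 0
indicator-trivial n n≤1 with 1 <ᵇ n in eq
... | false = refl
... | true  = contradiction (<ᵇ⇒< 1 n (subst T (sym eq) tt)) (≤⇒≯ n≤1)

splitsBelow-split : ∀ {c} (q : Seqᶜ c) j → 1 < card (q j) → splitsBelow q (suc j) ≡ suc (splitsBelow q j)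
splitsBelow-split q j 1<card = trans (cong (splitsBelow q j +_) (indicator-split _ 1<card)) (+-comm _ 1)

splitsBelow-trivial : ∀ {c} (q : Seqᶜ c) j → card (q j) ≤ 1 → splitsBelow q (suc j) ≡ splitsBelow q j
splitsBelow-trivial q j card≤1 = trans (cong (splitsBelow q j +_) (indicator-trivial _ card≤1)) (+-identityʳ _)

TrivialStretch : ∀ {c} → Seqᶜ c → ℕ → ℕ → Set
TrivialStretch q a b = ∀ {j} → a ≤ j → j < b → card (q j) ≤ 1

shrink-stretch : ∀ {c} (q : Seqᶜ c) {a b} → TrivialStretch q a (suc b) → TrivialStretch q a b
shrink-stretch q trivial a≤j j<b = trivial a≤j (m<n⇒m<1+n j<b)

splitsBelow-stretch : ∀ {c} (q : Seqᶜ c) {a b} → a ≤ b → TrivialStretch q a b → splitsBelow q b ≡ splitsBelow q a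
splitsBelow-stretch q a≤b = go (≤⇒≤′ a≤b)
  where
  go : ∀ {a b} → a ≤′ b → TrivialStretch q a b → splitsBelow q b ≡ splitsBelow q a
  go (≤′-reflexive refl) _     = refl
  go (≤′-step {b} a≤′b) trivial =
    trans (splitsBelow-trivial q b (trivial (≤′⇒≤ a≤′b) ≤-refl)) (go a≤′b (shrink-stretch q trivial))

possCard-stretch : ∀ {c} (q : Seqᶜ c) {a b} → a ≤ b → TrivialStretch q a b → possCard q b ≤ possCard q a
possCard-stretch q a≤b = go (≤⇒≤′ a≤b)
  where
  open ≤-Reasoning
  go : ∀ {a b} → a ≤′ b → TrivialStretch q a b → possCard q b ≤ possCard q a
  go (≤′-reflexive refl) _     = ≤-refl
  go {a} (≤′-step {b} a≤′b) trivial = begin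
    possCard q (suc b)         ≡⟨ possCard-suc q b ⟩
    possCard q b * card (q b)  ≤⟨ *-monoʳ-≤ (possCard q b) (trivial (≤′⇒≤ a≤′b) ≤-refl) ⟩
    possCard q b * 1           ≡⟨ *-identityʳ _ ⟩
    possCard q b               ≤⟨ go a≤′b (shrink-stretch q trivial) ⟩
    possCard q a               ∎

module StrictlyIncreasing (f : ℕ → ℕ) (f-step : ∀ m → f m < f (suc m)) where

  mono : ∀ {m n} → m ≤ n → f m ≤ f n
  mono m≤n = go (≤⇒≤′ m≤n)
    where
    go : ∀ {m n} → m ≤′ n → f m ≤ f n
    go (≤′-reflexive refl) = ≤-refl
    go (≤′-step m≤′n)      = ≤-trans (go m≤′n) (<⇒≤ (f-step _))

  reflects-< : ∀ {m n} → f m < f n → m < n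
  reflects-< {m} {n} fm<fn with m <? n
  ... | yes m<n = m<n
  ... | no  m≮n = contradiction (mono (≮⇒≥ m≮n)) (<⇒≱ fm<fn)

  ≤-self : ∀ m → m ≤ f m
  ≤-self zero    = z≤n
  ≤-self (suc m) = ≤-trans (s≤s (≤-self m)) (f-step m)

module Thinning (c h g : ℕ → ℕ) (h<c : ∀ i → h i < c i)
  (g→∞ : (k : ℕ) → Σ ℕ (λ N → (n : ℕ) → N ≤ n → k ≤ g n))
  (p : Seqᶜ c) (p∈ℚ : IsCondition c h p) where

  p-bounded : (n : ℕ) (X : Subset (c n)) → X ∈ˢ p n → ∣ X ∣ ≤ h n
  p-bounded = proj₁ p∈ℚ

  p-nonempty : (n : ℕ) → Σ (Subset (c n)) λ X → X ∈ˢ p n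
  p-nonempty = proj₁ (proj₂ p∈ℚ)

  p-unbounded : (k N : ℕ) → Σ ℕ λ n → N ≤ n × NormAtLeast (p n) k
  p-unbounded = proj₂ (proj₂ p∈ℚ)

  choose : (m lo B : ℕ) → Σ ℕ λ k → lo ≤ k × B < g k × NormAtLeast (p k) (suc m)
  choose m lo B with g→∞ (suc B)
  ... | N , g-large with p-unbounded (suc m) (lo ⊔ N)
  ... | k , lo⊔N≤k , norm = k , ≤-trans (m≤m⊔n lo N) lo⊔N≤k , g-large k (≤-trans (m≤n⊔m lo N) lo⊔N≤k) , norm

  -- The chosen levels k_m = point m, the lower limit for choosing k_m, and
  -- the bound B_m = Π_{i<m} |p(k_i)| on the possibilities below k_m.
  point lowest bound : ℕ → ℕ
  point m = proj₁ (choose m (lowest m) (bound m))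
  lowest zero    = 0
  lowest (suc m) = suc (point m)
  bound zero    = 1
  bound (suc m) = bound m * card (p (point m))

  lowest≤point : ∀ m → lowest m ≤ point m
  lowest≤point m = proj₁ (proj₂ (choose m (lowest m) (bound m)))

  bound<g : ∀ m → bound m < g (point m)
  bound<g m = proj₁ (proj₂ (proj₂ (choose m (lowest m) (bound m))))

  point-norm : ∀ m → NormAtLeast (p (point m)) (suc m)
  point-norm m = proj₂ (proj₂ (proj₂ (choose m (lowest m) (bound m))))

  open StrictlyIncreasing point (λ m → lowest≤point (suc m))

  IsPoint : ℕ → Set
  IsPoint ℓ = Σ ℕ λ m → point m ≡ ℓ

  -- Since point m ≥ m, being a chosen level is a bounded search.
  isPoint? : ∀ ℓ → Dec (IsPoint ℓ)
  isPoint? ℓ = map′ (λ { (m , _ , e) → m , e })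
                    (λ { (m , e) → m , s≤s (subst (m ≤_) e (≤-self m)) , e })
                    (anyUpTo? (λ m → point m ≟ ℓ) (suc ℓ))

  noPointBefore : ∀ m {j} → lowest m ≤ j → j < point m → ¬ IsPoint j
  noPointBefore zero    _      j<pt (m' , refl) = n≮0 (reflects-< j<pt)
  noPointBefore (suc m) lo≤j j<pt (m' , refl) =
    n≮n (point m) (<-≤-trans lo≤j (mono (≤-pred (reflects-< j<pt))))

  witness : (ℓ : ℕ) → Subset (c ℓ)
  witness ℓ = proj₁ (p-nonempty ℓ)

  q : Seqᶜ c
  q ℓ with isPoint? ℓ
  ... | yes _ = p ℓ
  ... | no  _ = singleton (witness ℓ)

  q-at-point : ∀ {ℓ} → IsPoint ℓ → q ℓ ≡ p ℓ
  q-at-point {ℓ} pt with isPoint? ℓ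
  ... | yes _  = refl
  ... | no ¬pt = contradiction pt ¬pt

  q-off-point : ∀ {ℓ} → ¬ IsPoint ℓ → card (q ℓ) ≤ 1
  q-off-point {ℓ} ¬pt with isPoint? ℓ
  ... | yes pt = contradiction pt ¬pt
  ... | no  _  = card-singleton (witness ℓ)

  q≤p : q ≤ᶜ p
  q≤p ℓ X X∈q with isPoint? ℓ
  ... | yes _ = X∈q
  ... | no  _ = subst (_∈ˢ p ℓ) (sym (∈-singleton X∈q)) (proj₂ (p-nonempty ℓ))

  q-nonempty : ∀ ℓ → witness ℓ ∈ˢ q ℓ
  q-nonempty ℓ with isPoint? ℓ
  ... | yes _ = proj₂ (p-nonempty ℓ)
  ... | no  _ = singleton-self (witness ℓ)

  split⇒point : ∀ {ℓ} → 1 < card (q ℓ) → IsPoint ℓ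
  split⇒point {ℓ} 1<card = decidable-stable (isPoint? ℓ) (λ ¬pt → ≤⇒≯ (q-off-point ¬pt) 1<card)

  -- ... and every chosen level splits, as c > h makes ‖p(k_m)‖ ≥ 1 force |p(k_m)| ≥ 2.
  point-splits : ∀ m → 1 < card (q (point m))
  point-splits m rewrite q-at-point (m , refl) =
    norm≥1⇒card≥2 (p (point m)) (λ X X∈p → ≤-<-trans (p-bounded _ X X∈p) (h<c _))
                  (NormAtLeast-mono _ (s≤s z≤n) (point-norm m))

  stretch-before : ∀ m → TrivialStretch q (lowest m) (point m)
  stretch-before m lo≤j j<pt = q-off-point (noPointBefore m lo≤j j<pt)

  splitsBelow-point : ∀ m → splitsBelow q (point m) ≡ m
  splitsBelow-point zero    = splitsBelow-stretch q (lowest≤point 0) (stretch-before 0)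
  splitsBelow-point (suc m) = begin
    splitsBelow q (point (suc m))   ≡⟨ splitsBelow-stretch q (lowest≤point (suc m)) (stretch-before (suc m)) ⟩
    splitsBelow q (suc (point m))   ≡⟨ splitsBelow-split q (point m) (point-splits m) ⟩
    suc (splitsBelow q (point m))   ≡⟨ cong suc (splitsBelow-point m) ⟩
    suc m                           ∎
    where open ≡-Reasoning

  possCard-point : ∀ m → possCard q (point m) ≤ bound m
  possCard-point zero    = possCard-stretch q (lowest≤point 0) (stretch-before 0)
  possCard-point (suc m) = begin
    possCard q (point (suc m))                  ≤⟨ possCard-stretch q (lowest≤point (suc m)) (stretch-before (suc m)) ⟩
    possCard q (suc (point m))                  ≡⟨ possCard-suc q (point m) ⟩
    possCard q (point m) * card (q (point m))   ≡⟨ cong (λ M → possCard q (point m) * card M) (q-at-point (m , refl)) ⟩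
    possCard q (point m) * card (p (point m))   ≤⟨ *-monoˡ-≤ (card (p (point m))) (possCard-point m) ⟩
    bound (suc m)                               ∎
    where open ≤-Reasoning

  q∈ℚ : IsCondition c h q
  q∈ℚ = (λ n X X∈q → p-bounded n X (q≤p n X X∈q))
      , (λ n → witness n , q-nonempty n)
      , λ k N → point (k ⊔ N)
              , ≤-trans (m≤n⊔m k N) (≤-self (k ⊔ N))
              , subst (λ M → NormAtLeast M k) (sym (q-at-point (k ⊔ N , refl)))
                  (NormAtLeast-mono _ (m≤n⇒m≤1+n (m≤m⊔n k N)) (point-norm (k ⊔ N)))

  q-star : (n k : ℕ) → IsSplit q n k → NormAtLeast (q k) (suc n)
  q-star n k (1<card , splits≡n) with split⇒point 1<card
  ... | m , refl with trans (sym (splitsBelow-point m)) splits≡n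
  ... | refl = subst (λ M → NormAtLeast M (suc m)) (sym (q-at-point (m , refl))) (point-norm m)

  q-few-possibilities : (n k : ℕ) → IsSplit q n k → possCard q k < g k
  q-few-possibilities n k (1<card , _) with split⇒point 1<card
  ... | m , refl = ≤-<-trans (possCard-point m) (bound<g m)

lemma3p8 : (c h g : ℕ → ℕ)
    → ((i : ℕ) → h i < c i)
    → Σ ℕ (λ N → (i : ℕ) → N ≤ i → 1 ≤ h i)
    → ((k : ℕ) → Σ ℕ (λ N → (n : ℕ) → N ≤ n → k ≤ g n))
    → (p : Seqᶜ c) → IsCondition c h p
    → Σ (Seqᶜ c) (λ q → q ≤ᶜ p × IsStarCondition c h q
        × ((n k : ℕ) → IsSplit q n k → possCard q k < g k))
lemma3p8 c h g h<c _ g→∞ p p∈ℚ = q , q≤p , (q∈ℚ , q-star) , q-few-possibilities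
  where open Thinning c h g h<c g→∞ p p∈ℚ
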